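{- Let $l,n,\lambda\ge 0$ be integers such that $\lambda\ge l^{n+1}n!$. For every sequence $S_1,S_2,\dots,S_\lambda$ of subsets of $\{1,\dots,n\}$ there exist integers $1\le i_0<i_1<\dots<i_l\le\lambda+1$ such that $$S_{i_0}\cup S_{i_0+1}\cup\dots\cup S_{i_1-1}=S_{i_1}\cup S_{i_1+1}\cup\dots\cup S_{i_2-1}=\dots=S_{i_{l-1}}\cup\dots\cup S_{i_l-1}.$$ -}

module Defs where

open import Data.Nat using (ℕ; zero; suc; _+_; _∸_; _<?_)
open import Data.Fin using (Fin; fromℕ<)
open import Data.Fin.Subset using (Subset; _∪_; ⊥)
open import Relation.Nullary using (yes; no)

-- A sequence S_1, …, S_λ of subsets of {1,…,n} is given as  S : Fin Λ → Subset n,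
-- where the paper's S_j (1 ≤ j ≤ λ) is  S (j - 1).

-- The paper's S_j for a 1-based index j; out-of-range indices give ∅
-- (never used in the theorem, whose constraints keep indices in range).
at : ∀ {Λ n} → (Fin Λ → Subset n) → ℕ → Subset n
at {Λ} S zero = ⊥
at {Λ} S (suc j) with j <? Λ
... | yes p = S (fromℕ< p)
... | no _ = ⊥

unionFrom : ∀ {Λ n} → (Fin Λ → Subset n) → ℕ → ℕ → Subset n
unionFrom S a zero = ⊥
unionFrom S a (suc k) = at S a ∪ unionFrom S (suc a) k

blockUnion : ∀ {Λ n} → (Fin Λ → Subset n) → ℕ → ℕ → Subset n
blockUnion S a b = unionFrom S a (b ∸ a)

-- By induction on m: if
-- every S_j in a window of length l^(m+1) lies in a set T with |T| ≤ m, cut the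
-- window into l consecutive blocks of length l^m.  Either every block has union
-- exactly T, and the block boundaries form the required chain, or some block has
-- a union U ⊊ T, so |U| ≤ m - 1 and the induction hypothesis applies inside that
-- block.  Start with T = {1, …, n} and m = n.

module Submission where

open import Defs
open import Data.Nat using (ℕ; _≤_; _<_; _^_; _*_; suc; _!)
open import Data.Fin using (Fin; zero; suc; fromℕ; inject₁)
open import Data.Fin.Subset using (Subset)
open import Relation.Binary.PropositionalEquality using (_≡_)

open import Data.Bool.Properties using () renaming (_≟_ to _≟ᵇ_)
open import Data.Empty using (⊥-elim)
open import Data.Fin using (toℕ)
open import Data.Fin.Properties using (toℕ<n; toℕ-fromℕ; toℕ-inject₁; all?; ¬∀⟶∃¬)
open import Data.Fin.Subset using (_⊆_; _∪_; ∣_∣; inside; outside)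
open import Data.Fin.Subset.Properties
  using (drop-∷-⊆; p⊆q⇒∣p∣≤∣q∣; p⊆p∪q; q⊆p∪q; x∈p∪q⁻; ⊆-min; ⊆-max; ∣⊤∣≡n)
open import Data.Nat using (zero; _+_; z≤n; s≤s; z<s; NonZero)
open import Data.Nat.Properties
open import Data.Product using (Σ; _×_; _,_)
open import Data.Sum using (inj₁; inj₂)
open import Data.Vec using ([]; _∷_; here)
open import Data.Vec.Properties using (≡-dec)
open import Relation.Binary using (Decidable)
open import Relation.Binary.PropositionalEquality using (refl; sym; trans; cong; subst; module ≡-Reasoning)
open import Relation.Nullary using (yes; no; ¬_)

p⊆q⇒∣p∣≡∣q∣⇒p≡q : ∀ {n} {p q : Subset n} → p ⊆ q → ∣ p ∣ ≡ ∣ q ∣ → p ≡ q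
p⊆q⇒∣p∣≡∣q∣⇒p≡q {p = []}          {[]}          _   _ = refl
p⊆q⇒∣p∣≡∣q∣⇒p≡q {p = outside ∷ p} {outside ∷ q} p⊆q e =
  cong (outside ∷_) (p⊆q⇒∣p∣≡∣q∣⇒p≡q (drop-∷-⊆ p⊆q) e)
p⊆q⇒∣p∣≡∣q∣⇒p≡q {p = outside ∷ p} {inside ∷ q}  p⊆q e =
  ⊥-elim (<-irrefl e (s≤s (p⊆q⇒∣p∣≤∣q∣ (drop-∷-⊆ p⊆q))))
p⊆q⇒∣p∣≡∣q∣⇒p≡q {p = inside ∷ p}  {outside ∷ q} p⊆q e with p⊆q here
... | ()
p⊆q⇒∣p∣≡∣q∣⇒p≡q {p = inside ∷ p}  {inside ∷ q}  p⊆q e =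
  cong (inside ∷_) (p⊆q⇒∣p∣≡∣q∣⇒p≡q (drop-∷-⊆ p⊆q) (suc-injective e))

p⊆q⇒p≢q⇒∣p∣<∣q∣ : ∀ {n} {p q : Subset n} → p ⊆ q → ¬ p ≡ q → ∣ p ∣ < ∣ q ∣
p⊆q⇒p≢q⇒∣p∣<∣q∣ p⊆q p≢q =
  ≤∧≢⇒< (p⊆q⇒∣p∣≤∣q∣ p⊆q) (λ e → p≢q (p⊆q⇒∣p∣≡∣q∣⇒p≡q p⊆q e))

∪-least : ∀ {n} {p q r : Subset n} → p ⊆ r → q ⊆ r → p ∪ q ⊆ r
∪-least {p = p} {q} p⊆r q⊆r x∈p∪q with x∈p∪q⁻ p q x∈p∪q
... | inj₁ x∈p = p⊆r x∈p
... | inj₂ x∈q = q⊆r x∈q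

_≟ˢ_ : ∀ {n} → Decidable {A = Subset n} _≡_
_≟ˢ_ = ≡-dec _≟ᵇ_

block-end≤ : ∀ b M {l} (k : Fin l) → b + toℕ k * M + M ≤ b + l * M
block-end≤ b M {l} k = begin
  b + toℕ k * M + M   ≡⟨ +-assoc b (toℕ k * M) M ⟩
  b + (toℕ k * M + M) ≡⟨ cong (b +_) (+-comm (toℕ k * M) M) ⟩
  b + suc (toℕ k) * M ≤⟨ +-monoʳ-≤ b (*-monoˡ-≤ M (toℕ<n k)) ⟩
  b + l * M           ∎
  where open ≤-Reasoning

module _ {Λ n : ℕ} (S : Fin Λ → Subset n) where

  Covers : Subset n → ℕ → ℕ → Set
  Covers T a e = ∀ j → a ≤ j → j < e → at S j ⊆ T

  unionFrom-covers : ∀ a k → Covers (unionFrom S a k) a (a + k)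
  unionFrom-covers a zero    j a≤j j<a rewrite +-identityʳ a = ⊥-elim (<⇒≱ j<a a≤j)
  unionFrom-covers a (suc k) j a≤j j<a+k with m≤n⇒m<n∨m≡n a≤j
  ... | inj₂ refl = p⊆p∪q _
  ... | inj₁ a<j  = λ x∈ → q⊆p∪q (at S a) _
        (unionFrom-covers (suc a) k j a<j (subst (j <_) (+-suc a k) j<a+k) x∈)

  unionFrom-least : ∀ a k {T} → Covers T a (a + k) → unionFrom S a k ⊆ T
  unionFrom-least a zero    {T} _      = ⊆-min T
  unionFrom-least a (suc k) {T} T-covers = ∪-least (T-covers a ≤-refl (m<m+n a z<s))
    (unionFrom-least (suc a) k λ j a<j j<a+k →
      T-covers j (<⇒≤ a<j) (subst (j <_) (sym (+-suc a k)) j<a+k))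

  EqualUnionChain : ℕ → ℕ → ℕ → Set
  EqualUnionChain l b e = Σ (Fin (suc l) → ℕ) λ i →
      (b ≤ i zero)
    × ((k : Fin l) → i (inject₁ k) < i (suc k))
    × (i (fromℕ l) ≤ e)
    × ((k m : Fin l) → blockUnion S (i (inject₁ k)) (i (suc k)) ≡ blockUnion S (i (inject₁ m)) (i (suc m)))

  EqualUnionChain-mono : ∀ {l b b′ e e′} → b′ ≤ b → e ≤ e′
                       → EqualUnionChain l b e → EqualUnionChain l b′ e′
  EqualUnionChain-mono b′≤b e≤e′ (i , b≤i₀ , i↑ , iₗ≤e , eq) =
    i , ≤-trans b′≤b b≤i₀ , i↑ , ≤-trans iₗ≤e e≤e′ , eq

  block : ℕ → ℕ → ℕ → Subset n
  block b M k = unionFrom S (b + k * M) M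

  block-⊆ : ∀ {l} b M {T} (k : Fin l) → Covers T b (b + l * M) → block b M (toℕ k) ⊆ T
  block-⊆ b M k T-covers = unionFrom-least (b + toℕ k * M) M λ j lo hi →
    T-covers j (≤-trans (m≤m+n b _) lo) (<-≤-trans hi (block-end≤ b M k))

  equalBlocks⇒chain : ∀ {l} b {M T} → 0 < M → (∀ (k : Fin l) → block b M (toℕ k) ≡ T)
                    → EqualUnionChain l b (b + l * M)
  equalBlocks⇒chain {l} b {M} {T} M>0 blocks≡T =
    i , m≤m+n b _ , i↑ , iₗ≤e , λ k m → trans (blockUnion≡T k) (sym (blockUnion≡T m))
    where
    i : Fin (suc l) → ℕ
    i k = b + toℕ k * M

    i-step : ∀ (k : Fin l) → i (suc k) ≡ i (inject₁ k) + M
    i-step k = begin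
      b + (M + toℕ k * M)         ≡⟨ cong (b +_) (+-comm M (toℕ k * M)) ⟩
      b + (toℕ k * M + M)         ≡⟨ sym (+-assoc b (toℕ k * M) M) ⟩
      b + toℕ k * M + M           ≡⟨ cong (λ t → b + t * M + M) (sym (toℕ-inject₁ k)) ⟩
      b + toℕ (inject₁ k) * M + M ∎
      where open ≡-Reasoning

    i↑ : ∀ (k : Fin l) → i (inject₁ k) < i (suc k)
    i↑ k rewrite i-step k = m<m+n _ M>0

    iₗ≤e : i (fromℕ l) ≤ b + l * M
    iₗ≤e rewrite toℕ-fromℕ l = ≤-refl

    blockUnion≡T : ∀ (k : Fin l) → blockUnion S (i (inject₁ k)) (i (suc k)) ≡ T
    blockUnion≡T k rewrite i-step k | m+n∸m≡n (i (inject₁ k)) M | toℕ-inject₁ k = blocks≡T k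

  module _ (L : ℕ) .{{_ : NonZero L}} where

    chain-in-window : ∀ m b {T} → ∣ T ∣ ≤ m → Covers T b (b + L ^ suc m)
                    → EqualUnionChain L b (b + L ^ suc m)
    chain-in-window m b {T} ∣T∣≤m T-covers with all? (λ (k : Fin L) → block b (L ^ m) (toℕ k) ≟ˢ T)
    ... | yes blocks≡T = equalBlocks⇒chain b (m^n>0 L m) blocks≡T
    ... | no  blocks≢T with ¬∀⟶∃¬ L _ (λ k → block b (L ^ m) (toℕ k) ≟ˢ T) blocks≢T
    ...   | k , block≢T with ≤-trans (p⊆q⇒p≢q⇒∣p∣<∣q∣ (block-⊆ b _ k T-covers) block≢T) ∣T∣≤m
    chain-in-window zero    b _ _ | no _ | _ , _ | ()
    chain-in-window (suc m) b _ _ | no _ | k , _ | s≤s ∣block∣≤m =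
      EqualUnionChain-mono (m≤m+n b _) (block-end≤ b (L ^ suc m) k)
        (chain-in-window m (b + toℕ k * L ^ suc m) ∣block∣≤m (unionFrom-covers _ _))

lemma3p4 : (l n Λ : ℕ) → l ^ (suc n) * n ! ≤ Λ → (S : Fin Λ → Subset n)
    → Σ (Fin (suc l) → ℕ) (λ i →
    (1 ≤ i zero)
    × ((k : Fin l) → i (inject₁ k) < i (suc k))
    × (i (fromℕ l) ≤ suc Λ)
    × ((k m : Fin l) → blockUnion S (i (inject₁ k)) (i (suc k)) ≡ blockUnion S (i (inject₁ m)) (i (suc m))))
lemma3p4 zero    n Λ _     S = (λ _ → 1) , ≤-refl , (λ ()) , s≤s z≤n , (λ ())
lemma3p4 (suc l) n Λ bound S =
  EqualUnionChain-mono S ≤-refl (s≤s (≤-trans (m≤m*n _ (n !) {{n !≢0}}) bound))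
    (chain-in-window S (suc l) n 1 (≤-reflexive (∣⊤∣≡n n)) λ _ _ _ → ⊆-max _)
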